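{- Let $\mathbf s$ be a perm-complete finite sequence in $\mathrm{Sym}(n)$. Then every finite sequence in $\mathrm{Sym}(n)$ obtained from $\mathbf s$ by inserting additional terms (arbitrary elements of $\mathrm{Sym}(n)$) is perm-complete.
   Context: $n=\{0,1,\ldots,n-1\}$; $\mathrm{Sym}(n)$, $\mathrm{Alt}(n)$ are the symmetric and alternating groups; permutations compose left to right. For $\mathbf s=\langle s_0,\ldots,s_{k-1}\rangle$ in $\mathrm{Sym}(n)$, $\bigcirc\mathbf s=s_0\circ\cdots\circ s_{k-1}$, $\mathrm{Seq}(\mathbf s)$ is the set of all rearrangements of $\mathbf s$, and $\mathrm{Prod}(\mathbf s)=\{\bigcirc\mathbf r:\mathbf r\in\mathrm{Seq}(\mathbf s)\}$. $\mathbf s$ is perm-complete iff $\mathrm{Prod}(\mathbf s)\in\{\mathrm{Alt}(n),\mathrm{Sym}(n)\setminus\mathrm{Alt}(n)\}$. -}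

module Defs where

open import Data.Nat using (ℕ)
open import Data.Nat.Base using (_<_)
open import Data.Fin using (Fin; toℕ; _<_)
open import Data.Fin.Permutation using (Permutation′; id; _∘ₚ_; _⟨$⟩ʳ_)
open import Data.List using (List; []; _∷_; length; filter; allFin; concatMap)
open import Data.List.Relation.Binary.Permutation.Propositional using (_↭_)
open import Data.Bool using (Bool; true; false)
open import Data.Nat using (_%_)
open import Data.Product using (Σ; _×_; _,_)
open import Data.Sum using (_⊎_)
open import Relation.Binary.PropositionalEquality using (_≡_)
open import Relation.Nullary.Decidable using (⌊_⌋)
import Data.Fin.Properties as FinP

-- Sym(n) is Permutation′ n; elements are compared pointwise.
_≈ₚ_ : {n : ℕ} → Permutation′ n → Permutation′ n → Set
_≈ₚ_ {n} p q = (i : Fin n) → p ⟨$⟩ʳ i ≡ q ⟨$⟩ʳ i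

-- left-to-right product  ⊙⟨s₀,…,s_{k-1}⟩ = s₀ ∘ ⋯ ∘ s_{k-1}
-- (π₁ ∘ₚ π₂ applies π₁ first); empty product is the identity
⊙ : {n : ℕ} → List (Permutation′ n) → Permutation′ n
⊙ []       = id
⊙ (s ∷ ss) = s ∘ₚ ⊙ ss

inversions : {n : ℕ} → Permutation′ n → ℕ
inversions {n} p =
  length (filter (λ ij → FinP._<?_ (p ⟨$⟩ʳ Data.Product.proj₂ ij) (p ⟨$⟩ʳ Data.Product.proj₁ ij))
    (concatMap (λ i → filter (λ ij → FinP._<?_ (Data.Product.proj₁ ij) (Data.Product.proj₂ ij))
                                (Data.List.map (λ j → (i , j)) (allFin n)))
               (allFin n)))
  where import Data.Product; import Data.List

IsEven : {n : ℕ} → Permutation′ n → Set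
IsEven p = inversions p % 2 ≡ 0

IsOdd : {n : ℕ} → Permutation′ n → Set
IsOdd p = inversions p % 2 ≡ 1

InProd : {n : ℕ} → List (Permutation′ n) → Permutation′ n → Set
InProd s p = Σ _ λ r → (r ↭ s) × (⊙ r ≈ₚ p)

ProdIs : {n : ℕ} → List (Permutation′ n) → (Permutation′ n → Set) → Set
ProdIs {n} s P = (p : Permutation′ n) → (InProd s p → P p) × (P p → InProd s p)

PermComplete : {n : ℕ} → List (Permutation′ n) → Set
PermComplete s = ProdIs s IsEven ⊎ ProdIs s IsOdd

module Submission where

-- Every permutation is read through its parity, the number of its inversions
-- modulo 2, and the proof shows that Prod(s) of a perm-complete s is a parity
-- class which inserting terms only shifts.
--
-- For g : Fin n → Fin n → ℕ write ∑< g = Σ_{i<j} g i j.  If g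
--    is symmetric with zero diagonal, the full double sum is 2 · ∑< g; the full
--    sum is invariant under relabelling by a permutation π, hence so is ∑< g.
--  * Unfolding the list definition, inversions p = ∑< [p j < p i].
--  * Parity is a homomorphism: a pair i < j is inverted by p ∘ₚ q iff exactly
--    one of "p inverts (i,j)" and "q inverts {p i, p j}" holds; the latter is a
--    symmetric function of (p i, p j), so its pair sum is the inversion count
--    of q.  Consequently the parity of ⊙ r does not depend on the order of r.
--  * Cosets: if Prod(s) is the parity class c then Prod(u ++ s) is the class
--    inv(⊙ u) + c (for ⊇ write p = ⊙ u ∘ q and cancel inv(⊙ u) modulo 2).
--  * A supersequence t of s is a rearrangement of u ++ s, and Prod is invariant
--    under rearrangement, so Prod(t) is a parity class: t is perm-complete.

open import Defs
open import Data.Bool using (Bool; true; false; not; _xor_)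
open import Data.Bool.Properties using (not-distribˡ-xor; not-distribʳ-xor; not-involutive)
open import Data.Empty using (⊥-elim)
open import Data.Fin using (Fin; zero; suc; _<_; _≟_)
open import Data.Fin.Permutation using (Permutation′; _⟨$⟩ʳ_; _⟨$⟩ˡ_; _∘ₚ_; id; flip; inverseˡ)
open import Data.Fin.Properties using (_<?_; <-cmp; <-irrefl; <-asym)
open import Data.List using (List; []; _∷_; _++_; length; filter; concatMap; tabulate; map; allFin)
open import Data.List.Properties using (length-++; filter-++; map-tabulate)
open import Data.List.Relation.Binary.Permutation.Propositional using (_↭_; ↭-refl; ↭-sym; ↭-trans; prep)
open import Data.List.Relation.Binary.Permutation.Propositional.Properties using (map⁺; ++⁺ˡ; shift)
open import Data.List.Relation.Binary.Sublist.Propositional using (_⊆_; []; _∷ʳ_; _∷_)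
open import Data.Nat using (ℕ; zero; suc; _+_; _*_; _%_; s≤s)
open import Data.Nat.DivMod using (%-distribˡ-+; %-remove-+ˡ; m%n<n)
open import Data.Nat.Divisibility using (divides)
open import Data.Nat.ListAction using () renaming (sum to sumList)
open import Data.Nat.ListAction.Properties using () renaming (sum-↭ to sumList-↭)
open import Data.Nat.Properties
  using (+-assoc; +-identityʳ; *-distribˡ-+; *-cancelˡ-≡; *-suc; *-identityʳ; +-0-commutativeMonoid)
open import Algebra.Properties.CommutativeMonoid.Sum +-0-commutativeMonoid
  using (sum; sum-cong-≗; ∑-distrib-+; ∑-comm; sum-permute)
open import Data.Product using (Σ; _×_; _,_; proj₁; proj₂)
open import Level using (0ℓ)
open import Relation.Binary.Bundles using (Setoid)
import Relation.Binary.Reasoning.Setoid as SetoidReasoning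
open import Data.Sum using (_⊎_; inj₁; inj₂) renaming (map to ⊎-map)
open import Relation.Binary.Definitions using (tri<; tri≈; tri>)
open import Relation.Binary.PropositionalEquality
  using (_≡_; refl; sym; trans; cong; cong₂; module ≡-Reasoning)
open import Relation.Nullary using (does; yes; no; ¬_)
open import Relation.Nullary.Decidable using (dec-true; dec-false)
open import Relation.Unary using (Decidable)

-- Congruence modulo 2.  It is wrapped in a record so that the two sides can be
-- inferred from the type (the function _% 2 is not injective).
infix 4 _≡₂_
record _≡₂_ (a b : ℕ) : Set where
  constructor mod₂
  field unmod₂ : a % 2 ≡ b % 2
open _≡₂_

≡₂-setoid : Setoid 0ℓ 0ℓ
≡₂-setoid = record
  { Carrier       = ℕ
  ; _≈_           = _≡₂_
  ; isEquivalence = record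
    { refl  = mod₂ refl
    ; sym   = λ a≡b → mod₂ (sym (unmod₂ a≡b))
    ; trans = λ a≡b b≡c → mod₂ (trans (unmod₂ a≡b) (unmod₂ b≡c))
    }
  }
open Setoid ≡₂-setoid using () renaming (refl to ≡₂-refl; sym to ≡₂-sym; trans to ≡₂-trans)

+-cong₂ : ∀ {a a′ b b′} → a ≡₂ a′ → b ≡₂ b′ → a + b ≡₂ a′ + b′
+-cong₂ {a} {a′} {b} {b′} (mod₂ a≡a′) (mod₂ b≡b′) = mod₂ (begin
  (a + b) % 2            ≡⟨ %-distribˡ-+ a b 2 ⟩
  (a % 2 + b % 2) % 2    ≡⟨ cong₂ (λ x y → (x + y) % 2) a≡a′ b≡b′ ⟩
  (a′ % 2 + b′ % 2) % 2  ≡⟨ %-distribˡ-+ a′ b′ 2 ⟨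
  (a′ + b′) % 2          ∎)
  where open ≡-Reasoning

+-double₂ : ∀ a b → a + (a + b) ≡₂ b
+-double₂ a b = mod₂ (trans (cong (_% 2) (sym (+-assoc a a b))) (%-remove-+ˡ b (divides a a+a≡a*2)))
  where
    a+a≡a*2 : a + a ≡ a * 2
    a+a≡a*2 = sym (trans (*-suc a 1) (cong (a +_) (*-identityʳ a)))

+-cancelˡ₂ : ∀ a {b c} → a + b ≡₂ a + c → b ≡₂ c
+-cancelˡ₂ a {b} {c} e =
  ≡₂-trans (≡₂-sym (+-double₂ a b)) (≡₂-trans (+-cong₂ (≡₂-refl {a}) e) (+-double₂ a c))

residue₂ : ∀ c → c % 2 ≡ 0 ⊎ c % 2 ≡ 1
residue₂ c with c % 2 | m%n<n c 2
... | 0           | _              = inj₁ refl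
... | 1           | _              = inj₂ refl
... | suc (suc _) | s≤s (s≤s ())

sum-cong₂ : ∀ {n} {f g : Fin n → ℕ} → (∀ i → f i ≡₂ g i) → sum f ≡₂ sum g
sum-cong₂ {zero}  f≡g = ≡₂-refl
sum-cong₂ {suc n} f≡g = +-cong₂ (f≡g zero) (sum-cong₂ (λ i → f≡g (suc i)))

χ : Bool → ℕ
χ true  = 1
χ false = 0

[_<_] : ∀ {n} → Fin n → Fin n → ℕ
[ i < j ] = χ (does (i <? j))

χ-xor : ∀ a c → χ c ≡₂ χ a + χ (a xor c)
χ-xor true  true  = mod₂ refl
χ-xor true  false = mod₂ refl
χ-xor false c     = ≡₂-refl

count-concatMap : ∀ {A B : Set} {P : A → Set} (P? : Decidable P) (f : B → List A) {k} (h : Fin k → B) →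
                  length (filter P? (concatMap f (tabulate h))) ≡ sum (λ i → length (filter P? (f (h i))))
count-concatMap P? f {zero}  h = refl
count-concatMap {A} P? f {suc k} h = begin
  length (filter P? (f (h zero) ++ rest))                 ≡⟨ cong length (filter-++ P? (f (h zero)) rest) ⟩
  length (filter P? (f (h zero)) ++ filter P? rest)       ≡⟨ length-++ (filter P? (f (h zero))) ⟩
  length (filter P? (f (h zero))) + length (filter P? rest)
    ≡⟨ cong (length (filter P? (f (h zero))) +_) (count-concatMap P? f (λ i → h (suc i))) ⟩
  sum (λ i → length (filter P? (f (h i))))                ∎
  where
    open ≡-Reasoning
    rest : List A
    rest = concatMap f (tabulate (λ i → h (suc i)))

count-filter-filter : ∀ {A : Set} {P Q : A → Set} (P? : Decidable P) (Q? : Decidable Q) {k} (h : Fin k → A) →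
                      length (filter P? (filter Q? (tabulate h)))
                        ≡ sum (λ i → χ (does (Q? (h i))) * χ (does (P? (h i))))
count-filter-filter P? Q? {zero}  h = refl
count-filter-filter P? Q? {suc k} h
  with does (Q? (h zero)) | count-filter-filter P? Q? (λ i → h (suc i))
... | false | ih = ih
... | true  | ih with does (P? (h zero))
...   | false = ih
...   | true  = cong suc ih

module _ {n : ℕ} where

  ∑∑ : (Fin n → Fin n → ℕ) → ℕ
  ∑∑ g = sum (λ i → sum (λ j → g i j))

  ∑< : (Fin n → Fin n → ℕ) → ℕ
  ∑< g = ∑∑ (λ i j → [ i < j ] * g i j)

  ∑∑-cong : {g h : Fin n → Fin n → ℕ} → (∀ i j → g i j ≡ h i j) → ∑∑ g ≡ ∑∑ h
  ∑∑-cong g≡h = sum-cong-≗ (λ i → sum-cong-≗ (g≡h i))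

  ∑∑-distrib : (g h : Fin n → Fin n → ℕ) → ∑∑ (λ i j → g i j + h i j) ≡ ∑∑ g + ∑∑ h
  ∑∑-distrib g h = trans (sum-cong-≗ (λ i → ∑-distrib-+ (g i) (h i)))
                         (∑-distrib-+ (λ i → sum (g i)) (λ i → sum (h i)))

  ∑<-distrib : (g h : Fin n → Fin n → ℕ) → ∑< (λ i j → g i j + h i j) ≡ ∑< g + ∑< h
  ∑<-distrib g h = trans (∑∑-cong (λ i j → *-distribˡ-+ [ i < j ] (g i j) (h i j))) (∑∑-distrib _ _)

  ∑<-cong : (g h : Fin n → Fin n → ℕ) → (∀ {i j} → i < j → g i j ≡ h i j) → ∑< g ≡ ∑< h
  ∑<-cong g h g≡h = ∑∑-cong masked
    where
      masked : ∀ i j → [ i < j ] * g i j ≡ [ i < j ] * h i j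
      masked i j with i <? j
      ... | yes i<j rewrite dec-true (i <? j) i<j  = cong (_+ 0) (g≡h i<j)
      ... | no  i≮j rewrite dec-false (i <? j) i≮j = refl

  ∑<-cong₂ : (g h : Fin n → Fin n → ℕ) → (∀ i j → g i j ≡₂ h i j) → ∑< g ≡₂ ∑< h
  ∑<-cong₂ g h g≡h = sum-cong₂ (λ i → sum-cong₂ (masked i))
    where
      masked : ∀ i j → [ i < j ] * g i j ≡₂ [ i < j ] * h i j
      masked i j with does (i <? j)
      ... | true  = +-cong₂ (g≡h i j) ≡₂-refl
      ... | false = ≡₂-refl

  ∑∑-symmetric : (g : Fin n → Fin n → ℕ) → (∀ i j → g i j ≡ g j i) → (∀ i → g i i ≡ 0) →
                 ∑∑ g ≡ 2 * ∑< g
  ∑∑-symmetric g g-sym g-diag = begin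
    ∑∑ g                                                ≡⟨ ∑∑-cong split ⟩
    ∑∑ (λ i j → [ i < j ] * g i j + [ j < i ] * g i j)  ≡⟨ ∑∑-distrib _ _ ⟩
    ∑< g + ∑∑ (λ i j → [ j < i ] * g i j)               ≡⟨ cong (∑< g +_) lower-half ⟩
    ∑< g + ∑< g                                         ≡⟨ cong (∑< g +_) (+-identityʳ (∑< g)) ⟨
    2 * ∑< g                                            ∎
    where
      open ≡-Reasoning
      split : ∀ i j → g i j ≡ [ i < j ] * g i j + [ j < i ] * g i j
      split i j with <-cmp i j
      ... | tri< i<j _ j≮i rewrite dec-true (i <? j) i<j | dec-false (j <? i) j≮i =
        sym (trans (+-identityʳ _) (+-identityʳ _))
      ... | tri≈ i≮i refl _ rewrite dec-false (i <? i) i≮i | g-diag i = refl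
      ... | tri> i≮j _ j<i rewrite dec-false (i <? j) i≮j | dec-true (j <? i) j<i =
        sym (+-identityʳ _)
      lower-half : ∑∑ (λ i j → [ j < i ] * g i j) ≡ ∑< g
      lower-half = trans (∑∑-cong (λ i j → cong ([ j < i ] *_) (g-sym i j)))
                         (∑-comm (λ i j → [ j < i ] * g j i))

  ∑∑-permute : (g : Fin n → Fin n → ℕ) (π : Permutation′ n) →
               ∑∑ (λ i j → g (π ⟨$⟩ʳ i) (π ⟨$⟩ʳ j)) ≡ ∑∑ g
  ∑∑-permute g π = trans (sum-cong-≗ (λ i → sym (sum-permute (g (π ⟨$⟩ʳ i)) π)))
                         (sym (sum-permute (λ a → sum (g a)) π))

  ∑<-permute : (g : Fin n → Fin n → ℕ) (π : Permutation′ n) →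
               (∀ i j → g i j ≡ g j i) → (∀ i → g i i ≡ 0) →
               ∑< (λ i j → g (π ⟨$⟩ʳ i) (π ⟨$⟩ʳ j)) ≡ ∑< g
  ∑<-permute g π g-sym g-diag = *-cancelˡ-≡ _ _ 2 (begin
    2 * ∑< gπ  ≡⟨ ∑∑-symmetric gπ (λ i j → g-sym _ _) (λ i → g-diag _) ⟨
    ∑∑ gπ      ≡⟨ ∑∑-permute g π ⟩
    ∑∑ g       ≡⟨ ∑∑-symmetric g g-sym g-diag ⟩
    2 * ∑< g   ∎)
    where
      open ≡-Reasoning
      gπ : Fin n → Fin n → ℕ
      gπ i j = g (π ⟨$⟩ʳ i) (π ⟨$⟩ʳ j)

  inversions≡∑< : (p : Permutation′ n) → inversions p ≡ ∑< (λ i j → [ p ⟨$⟩ʳ j < p ⟨$⟩ʳ i ])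
  inversions≡∑< p = trans (count-concatMap inverted? pairsFrom (λ i → i)) (sum-cong-≗ row)
    where
      inverted? : Decidable (λ (ij : Fin n × Fin n) → p ⟨$⟩ʳ proj₂ ij < p ⟨$⟩ʳ proj₁ ij)
      inverted? ij = p ⟨$⟩ʳ proj₂ ij <? p ⟨$⟩ʳ proj₁ ij
      ordered? : Decidable (λ (ij : Fin n × Fin n) → proj₁ ij < proj₂ ij)
      ordered? ij = proj₁ ij <? proj₂ ij
      pairsFrom : Fin n → List (Fin n × Fin n)
      pairsFrom i = filter ordered? (map (i ,_) (allFin n))
      row : ∀ i → length (filter inverted? (pairsFrom i))
                    ≡ sum (λ j → [ i < j ] * [ p ⟨$⟩ʳ j < p ⟨$⟩ʳ i ])
      row i = trans (cong (λ xs → length (filter inverted? (filter ordered? xs)))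
                          (map-tabulate (λ j → j) (i ,_)))
                    (count-filter-filter inverted? ordered? (λ j → (i , j)))

  inversions-cong : (p q : Permutation′ n) → p ≈ₚ q → inversions p ≡ inversions q
  inversions-cong p q p≈q = begin
    inversions p                                      ≡⟨ inversions≡∑< p ⟩
    ∑< (λ i j → [ p ⟨$⟩ʳ j < p ⟨$⟩ʳ i ])
      ≡⟨ ∑∑-cong (λ i j → cong₂ (λ a b → [ i < j ] * [ a < b ]) (p≈q j) (p≈q i)) ⟩
    ∑< (λ i j → [ q ⟨$⟩ʳ j < q ⟨$⟩ʳ i ])             ≡⟨ inversions≡∑< q ⟨
    inversions q                                      ∎
    where open ≡-Reasoning

  ⟨$⟩ʳ-injective : (q : Permutation′ n) {a b : Fin n} → q ⟨$⟩ʳ a ≡ q ⟨$⟩ʳ b → a ≡ b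
  ⟨$⟩ʳ-injective q {a} {b} qa≡qb = trans (sym (inverseˡ q)) (trans (cong (q ⟨$⟩ˡ_) qa≡qb) (inverseˡ q))

  <?-flip : (a b : Fin n) → ¬ a ≡ b → does (b <? a) ≡ not (does (a <? b))
  <?-flip a b a≢b with <-cmp a b
  ... | tri< a<b _ b≮a rewrite dec-true (a <? b) a<b | dec-false (b <? a) b≮a = refl
  ... | tri≈ _ a≡b _ = ⊥-elim (a≢b a≡b)
  ... | tri> a≮b _ b<a rewrite dec-false (a <? b) a≮b | dec-true (b <? a) b<a = refl

  -- reversedBy q a b = 1 iff q reverses the relative order of the points a and b.
  reversedBy : Permutation′ n → Fin n → Fin n → ℕ
  reversedBy q a b = χ (does (b <? a) xor does (q ⟨$⟩ʳ b <? q ⟨$⟩ʳ a))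

  reversedBy-diag : (q : Permutation′ n) (a : Fin n) → reversedBy q a a ≡ 0
  reversedBy-diag q a rewrite dec-false (a <? a) (<-irrefl refl)
                            | dec-false (q ⟨$⟩ʳ a <? q ⟨$⟩ʳ a) (<-irrefl refl) = refl

  reversedBy-sym : (q : Permutation′ n) (a b : Fin n) → reversedBy q a b ≡ reversedBy q b a
  reversedBy-sym q a b with a ≟ b
  ... | yes refl = refl
  ... | no  a≢b  = cong χ (trans (cong₂ _xor_ (<?-flip a b a≢b) (<?-flip (q ⟨$⟩ʳ a) (q ⟨$⟩ʳ b) qa≢qb))
                                 (not-xor-not (does (a <? b)) (does (q ⟨$⟩ʳ a <? q ⟨$⟩ʳ b))))
    where
      qa≢qb : ¬ q ⟨$⟩ʳ a ≡ q ⟨$⟩ʳ b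
      qa≢qb qa≡qb = a≢b (⟨$⟩ʳ-injective q qa≡qb)
      not-xor-not : ∀ x y → not x xor not y ≡ x xor y
      not-xor-not x y = trans (sym (not-distribˡ-xor x (not y)))
                              (trans (cong not (sym (not-distribʳ-xor x y))) (not-involutive (x xor y)))

  ∑<-reversedBy : (q : Permutation′ n) → ∑< (reversedBy q) ≡ inversions q
  ∑<-reversedBy q = trans (∑<-cong (reversedBy q) (λ i j → [ q ⟨$⟩ʳ j < q ⟨$⟩ʳ i ]) reversed⇔inverted)
                          (sym (inversions≡∑< q))
    where
      reversed⇔inverted : ∀ {i j} → i < j → reversedBy q i j ≡ [ q ⟨$⟩ʳ j < q ⟨$⟩ʳ i ]
      reversed⇔inverted {i} {j} i<j =
        cong (λ b → χ (b xor does (q ⟨$⟩ʳ j <? q ⟨$⟩ʳ i))) (dec-false (j <? i) (<-asym i<j))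

  -- Parity of the number of inversions is a homomorphism Sym(n) → ℤ/2: a pair i < j is
  -- inverted by p ∘ₚ q iff exactly one of p and q (on p i, p j) reverses it.
  inversions-∘ : (p q : Permutation′ n) → inversions (p ∘ₚ q) ≡₂ inversions p + inversions q
  inversions-∘ p q = begin
    inversions (p ∘ₚ q)                         ≡⟨ inversions≡∑< (p ∘ₚ q) ⟩
    ∑< (λ i j → [ q ⟨$⟩ʳ (p ⟨$⟩ʳ j) < q ⟨$⟩ʳ (p ⟨$⟩ʳ i) ])
                                                ≈⟨ ∑<-cong₂ _ (λ i j → invertedBy-p i j + reversedBy-q i j)
                                                     (λ i j → χ-xor (does (p ⟨$⟩ʳ j <? p ⟨$⟩ʳ i)) _) ⟩
    ∑< (λ i j → invertedBy-p i j + reversedBy-q i j)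
                                                ≡⟨ ∑<-distrib invertedBy-p reversedBy-q ⟩
    ∑< invertedBy-p + ∑< reversedBy-q           ≡⟨ cong₂ _+_ (sym (inversions≡∑< p)) relabel ⟩
    inversions p + ∑< (reversedBy q)            ≡⟨ cong (inversions p +_) (∑<-reversedBy q) ⟩
    inversions p + inversions q                 ∎
    where
      open SetoidReasoning ≡₂-setoid
      invertedBy-p reversedBy-q : Fin n → Fin n → ℕ
      invertedBy-p i j = [ p ⟨$⟩ʳ j < p ⟨$⟩ʳ i ]
      reversedBy-q i j = reversedBy q (p ⟨$⟩ʳ i) (p ⟨$⟩ʳ j)
      relabel : ∑< reversedBy-q ≡ ∑< (reversedBy q)
      relabel = ∑<-permute (reversedBy q) p (reversedBy-sym q) (reversedBy-diag q)

  -- Like every homomorphism, inversion parity sends the identity to 0.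
  inversions-id : inversions (id {n}) ≡₂ 0
  inversions-id = +-cancelˡ₂ (inversions ι) (begin
    inversions ι + inversions ι   ≈⟨ inversions-∘ ι ι ⟨
    inversions (ι ∘ₚ ι)           ≡⟨ inversions-cong (ι ∘ₚ ι) ι (λ i → refl) ⟩
    inversions ι                  ≡⟨ +-identityʳ (inversions ι) ⟨
    inversions ι + 0              ∎)
    where
      open SetoidReasoning ≡₂-setoid
      ι : Permutation′ n
      ι = id

  inversions-⊙ : (r : List (Permutation′ n)) → inversions (⊙ r) ≡₂ sumList (map inversions r)
  inversions-⊙ []      = inversions-id
  inversions-⊙ (x ∷ r) = ≡₂-trans (inversions-∘ x (⊙ r)) (+-cong₂ ≡₂-refl (inversions-⊙ r))

  inversions-⊙-↭ : {r r′ : List (Permutation′ n)} → r ↭ r′ → inversions (⊙ r) ≡₂ inversions (⊙ r′)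
  inversions-⊙-↭ {r} {r′} r↭r′ = begin
    inversions (⊙ r)             ≈⟨ inversions-⊙ r ⟩
    sumList (map inversions r)   ≡⟨ sumList-↭ (map⁺ inversions r↭r′) ⟩
    sumList (map inversions r′)  ≈⟨ inversions-⊙ r′ ⟨
    inversions (⊙ r′)            ∎
    where open SetoidReasoning ≡₂-setoid

  ⊙-++ : (u r : List (Permutation′ n)) → ⊙ (u ++ r) ≈ₚ (⊙ u ∘ₚ ⊙ r)
  ⊙-++ []      r i = refl
  ⊙-++ (x ∷ u) r i = ⊙-++ u r (x ⟨$⟩ʳ i)

  ParityClass : ℕ → Permutation′ n → Set
  ParityClass c p = inversions p ≡₂ c

  ProdIs-↭ : {s s′ : List (Permutation′ n)} {P : Permutation′ n → Set} →
             s ↭ s′ → ProdIs s P → ProdIs s′ P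
  ProdIs-↭ s↭s′ H p = (λ (r , r↭s′ , ⊙r≈p) → proj₁ (H p) (r , ↭-trans r↭s′ (↭-sym s↭s′) , ⊙r≈p))
                    , (λ Pp → let (r , r↭s , ⊙r≈p) = proj₂ (H p) Pp in r , ↭-trans r↭s s↭s′ , ⊙r≈p)

  ProdIs-cong : {s : List (Permutation′ n)} {P Q : Permutation′ n → Set} →
                (∀ {p} → P p → Q p) → (∀ {p} → Q p → P p) → ProdIs s P → ProdIs s Q
  ProdIs-cong P⇒Q Q⇒P H p = (λ inProd → P⇒Q (proj₁ (H p) inProd)) , (λ Qp → proj₂ (H p) (Q⇒P Qp))

  -- Every p of the new class is ⊙ u ∘ₚ q with q = (⊙ u)⁻¹ ∘ₚ p
  -- in the old class, and q is realised by a rearrangement r of s.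
  ProdIs-++ : (u s : List (Permutation′ n)) (c : ℕ) →
              ProdIs s (ParityClass c) → ProdIs (u ++ s) (ParityClass (inversions (⊙ u) + c))
  ProdIs-++ u s c H p = parity-of-product , product-of-parity
    where
      open SetoidReasoning ≡₂-setoid
      parity-of-product : InProd (u ++ s) p → ParityClass (inversions (⊙ u) + c) p
      parity-of-product (r , r↭us , ⊙r≈p) = begin
        inversions p                          ≡⟨ inversions-cong (⊙ r) p ⊙r≈p ⟨
        inversions (⊙ r)                      ≈⟨ inversions-⊙-↭ r↭us ⟩
        inversions (⊙ (u ++ s))               ≡⟨ inversions-cong (⊙ (u ++ s)) (⊙ u ∘ₚ ⊙ s) (⊙-++ u s) ⟩
        inversions (⊙ u ∘ₚ ⊙ s)               ≈⟨ inversions-∘ (⊙ u) (⊙ s) ⟩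
        inversions (⊙ u) + inversions (⊙ s)   ≈⟨ +-cong₂ ≡₂-refl ⊙s-class ⟩
        inversions (⊙ u) + c                  ∎
        where
          ⊙s-class : ParityClass c (⊙ s)
          ⊙s-class = proj₁ (H (⊙ s)) (s , ↭-refl , λ i → refl)
      product-of-parity : ParityClass (inversions (⊙ u) + c) p → InProd (u ++ s) p
      product-of-parity p-class =
        let (r , r↭s , ⊙r≈q) = proj₂ (H q) q-class
        in  u ++ r
          , ++⁺ˡ u r↭s
          , λ i → trans (⊙-++ u r i) (trans (⊙r≈q (⊙ u ⟨$⟩ʳ i)) (⊙u∘q≈p i))
        where
          q : Permutation′ n
          q = flip (⊙ u) ∘ₚ p
          ⊙u∘q≈p : (⊙ u ∘ₚ q) ≈ₚ p
          ⊙u∘q≈p i = cong (p ⟨$⟩ʳ_) (inverseˡ (⊙ u))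
          q-class : ParityClass c q
          q-class = +-cancelˡ₂ (inversions (⊙ u)) (begin
            inversions (⊙ u) + inversions q   ≈⟨ inversions-∘ (⊙ u) q ⟨
            inversions (⊙ u ∘ₚ q)             ≡⟨ inversions-cong (⊙ u ∘ₚ q) p ⊙u∘q≈p ⟩
            inversions p                      ≈⟨ p-class ⟩
            inversions (⊙ u) + c              ∎)

  permComplete⇒parityClass : {s : List (Permutation′ n)} →
                             PermComplete s → Σ ℕ λ c → ProdIs s (ParityClass c)
  permComplete⇒parityClass (inj₁ even) = 0 , ProdIs-cong mod₂ unmod₂ even
  permComplete⇒parityClass (inj₂ odd)  = 1 , ProdIs-cong mod₂ unmod₂ odd

  parityClass⇒permComplete : {s : List (Permutation′ n)} (c : ℕ) → ProdIs s (ParityClass c) → PermComplete s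
  parityClass⇒permComplete {s} c H = ⊎-map reduce reduce (residue₂ c)
    where
      reduce : ∀ {b} → c % 2 ≡ b → ProdIs s (λ p → inversions p % 2 ≡ b)
      reduce c≡b = ProdIs-cong (λ e → trans (unmod₂ e) c≡b) (λ e → mod₂ (trans e (sym c≡b))) H

⊆⇒↭-++ : {A : Set} {s t : List A} → s ⊆ t → Σ (List A) λ u → t ↭ u ++ s
⊆⇒↭-++ [] = [] , ↭-refl
⊆⇒↭-++ (y ∷ʳ s⊆t) with ⊆⇒↭-++ s⊆t
... | u , t↭us = y ∷ u , prep y t↭us
⊆⇒↭-++ {s = x ∷ s} (refl ∷ s⊆t) with ⊆⇒↭-++ s⊆t
... | u , t↭us = u , ↭-trans (prep x t↭us) (↭-sym (shift x u s))

theorem2p1 : (n : ℕ) (s t : List (Permutation′ n)) →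
    PermComplete s → s ⊆ t → PermComplete t
theorem2p1 n s t s-complete s⊆t
  with ⊆⇒↭-++ s⊆t | permComplete⇒parityClass s-complete
... | u , t↭us | c , Prod-s =
  parityClass⇒permComplete (inversions (⊙ u) + c) (ProdIs-↭ (↭-sym t↭us) (ProdIs-++ u s c Prod-s))
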